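{- Let $m\ge 2$ and $\pi\in W_n^{ -1}(K_{1,m})$, and let $\{a\}$ and $\{b_1,\dots,b_m\}$ be the two parts of the copy of $K_{1,m}$ in $W(\pi)$, indexed so that the term of $\pi$ corresponding to $b_i$ lies to the left of that corresponding to $b_{i+1}$ for $1\le i\le m-1$. Then: (i) the term corresponding to $a$ lies to the right of the term corresponding to $b_{m-1}$; (ii) if $\pi_\alpha$ and $\pi_\beta$ are the terms corresponding to $a$ and $b_m$ respectively, then $\pi_\beta<\pi_\alpha$.
   Context: For $\pi=\pi_1\cdots\pi_n\in\mathcal{S}_n$, the digraph $D(\pi)$ has vertices $1,\dots,n$ (vertex $i$ identified with the term $\pi_i$) and an arc from $j$ to $i$ whenever $i<j$ and $\pi_i<\pi_j$. The weighted competition graph $W(\pi)$ is the edge-weighted simple graph on the same vertices in which distinct $u,v$ are joined by an edge iff they have a common out-neighbor in $D(\pi)$, with weight equal to the number of common out-neighbors. $K_{1,m}$ denotes the star with center $a$ and $m$ leaves, all edges of weight $1$. For an edge-weighted graph $G$, $W_n^{ -1}(G)$ is the set of $\pi\in\mathcal{S}_n$ such that $W(\pi)$ is isomorphic, as an edge-weighted graph, to $G$ together with some number of isolated vertices. -}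

module Defs where

open import Data.Nat using (ℕ; zero; suc; _+_; _≤ᵇ_)
open import Data.Bool using (Bool; true; false; if_then_else_; _∧_; _∨_)
open import Data.Fin using (Fin; toℕ; _<_; _<?_)
open import Data.Fin.Permutation using (Permutation; Permutation′; _⟨$⟩ʳ_)
open import Data.List using (length; filter; allFin)
open import Data.Product using (_×_; Σ; ∃)
open import Relation.Nullary using (¬_)
open import Relation.Nullary.Decidable using (_×-dec_; ⌊_⌋)
open import Relation.Binary.PropositionalEquality using (_≡_; _≢_)

-- Positions are Fin n (0-based); π i is the value of the term at position i.

Arc : ∀ {n} → Permutation′ n → Fin n → Fin n → Set
Arc π j i = (i < j) × ((π ⟨$⟩ʳ i) < (π ⟨$⟩ʳ j))

-- Number of common out-neighbours of u and v in D(π).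
weight : ∀ {n} → Permutation′ n → Fin n → Fin n → ℕ
weight {n} π u v =
  length (filter (λ k → ((k <? u) ×-dec ((π ⟨$⟩ʳ k) <? (π ⟨$⟩ʳ u)))
                        ×-dec ((k <? v) ×-dec ((π ⟨$⟩ʳ k) <? (π ⟨$⟩ʳ v))))
                 (allFin n))

-- Weight function of K_{1,m} together with k isolated vertices, on the
-- vertex set Fin (suc m + k): vertex 0 is the centre, vertices 1..m are
-- the leaves, the rest are isolated; non-edges have weight 0.
isLeaf : ∀ m {N} → Fin N → Bool
isLeaf m x = (1 ≤ᵇ toℕ x) ∧ (toℕ x ≤ᵇ m)

isCentre : ∀ {N} → Fin N → Bool
isCentre x = toℕ x ≤ᵇ 0

starWeight : ∀ m k → Fin (suc m + k) → Fin (suc m + k) → ℕ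
starWeight m k x y =
  if (isCentre x ∧ isLeaf m y) ∨ (isLeaf m x ∧ isCentre y) then 1 else 0

-- π ∈ W_n^{-1}(K_{1,m}): W(π) is isomorphic (as an edge-weighted graph,
-- edges = pairs of distinct vertices with positive weight) to K_{1,m}
-- plus some number k of isolated vertices.
InWInvStar : ∀ m {n} → Permutation′ n → Set
InWInvStar m {n} π =
  ∃ λ k → Σ (Permutation n (suc m + k)) λ σ →
    ∀ u v → u ≢ v → weight π u v ≡ starWeight m k (σ ⟨$⟩ʳ u) (σ ⟨$⟩ʳ v)

IsStarCopy : ∀ m {n} → Permutation′ n → Fin n → (Fin m → Fin n) → Set
IsStarCopy m {n} π a b =
  (∀ i j → b i ≡ b j → i ≡ j) ×
  (∀ i → b i ≢ a) ×
  (∀ i → weight π a (b i) ≡ 1) ×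
  (∀ u v → u ≢ v →
     ¬ (Σ (Fin m) λ i → (u ≡ a × v ≡ b i)) →
     ¬ (Σ (Fin m) λ i → (u ≡ b i × v ≡ a)) →
     weight π u v ≡ 0)

module Submission where

-- Let b_{m-1} = x and b_m = y be the two rightmost leaves (x < y as
-- positions).  In W(π) the pair x, y is a non-edge, so x and y have NO common
-- out-neighbour in D(π), while a x and a y are edges, so there are vertices
-- d (an out-neighbour of a and x) and c (an out-neighbour of a and y).
--
-- The whole argument rests on one "separation" fact: if u and v have no
-- common out-neighbour and k is an out-neighbour of u standing left of v,
-- then k must lie above v in value (otherwise v -> k is an arc too).
--  (ii) d is an out-neighbour of x left of y, so π y < π d < π a.
--  (i)  If a stood left of x, then c (left of a) and d (left of a) would be
--       left of both x and y; separation gives π x < π c and π y < π d, and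
--       with the arcs π c < π y and π d < π x this is a cycle π y < π y.

open import Defs
open import Data.Nat using (ℕ; suc)
open import Data.Fin using (Fin; _<_; _<?_; fromℕ; inject₁)
open import Data.Fin.Permutation using (Permutation′; _⟨$⟩ʳ_; _⟨$⟩ˡ_; inverseˡ)
open import Data.Product using (_×_; _,_; ∃; proj₁; proj₂)
open import Data.Fin.Properties using (<-cmp; <-trans; <-irrefl; <⇒≢; toℕ-inject₁; toℕ-fromℕ)
import Data.Nat as ℕ
import Data.Nat.Properties as ℕ
open import Data.List using (List; _∷_; length; filter; allFin)
open import Data.List.Properties using (filter-some)
open import Data.List.Membership.Propositional using (_∈_; lose)
open import Data.List.Membership.Propositional.Properties using (∈-filter⁻; ∈-allFin)
open import Data.List.Relation.Unary.Any using (here)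
open import Relation.Nullary using (¬_)
open import Relation.Nullary.Decidable using (_×-dec_)
open import Relation.Unary using (Pred; Decidable)
open import Relation.Binary using (tri<; tri≈; tri>)
open import Relation.Binary.PropositionalEquality using (_≡_; _≢_; refl; sym; trans; cong; subst)
open import Data.Empty using (⊥-elim)
open import Level using (0ℓ)

nonempty-member : ∀ {A : Set} (xs : List A) → 0 ℕ.< length xs → ∃ λ x → x ∈ xs
nonempty-member (x ∷ _) _ = x , here refl

module Counting {n : ℕ} {P : Pred (Fin n) 0ℓ} (P? : Decidable P) where

  count : ℕ
  count = length (filter P? (allFin n))

  count-positive⇒witness : 0 ℕ.< count → ∃ P
  count-positive⇒witness pos with nonempty-member _ pos
  ... | k , k∈ = k , proj₂ (∈-filter⁻ P? {xs = allFin n} k∈)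

  count-zero⇒none : count ≡ 0 → ∀ k → ¬ P k
  count-zero⇒none zero k pk =
    ℕ.<-irrefl (sym zero) (filter-some P? (lose (∈-allFin k) pk))

CommonOut : ∀ {n} → Permutation′ n → Fin n → Fin n → Pred (Fin n) 0ℓ
CommonOut π u v k = Arc π u k × Arc π v k

commonOut? : ∀ {n} (π : Permutation′ n) u v → Decidable (CommonOut π u v)
commonOut? π u v k =
  ((k <? u) ×-dec ((π ⟨$⟩ʳ k) <? (π ⟨$⟩ʳ u))) ×-dec ((k <? v) ×-dec ((π ⟨$⟩ʳ k) <? (π ⟨$⟩ʳ v)))

weight1⇒commonOut : ∀ {n} (π : Permutation′ n) u v → weight π u v ≡ 1 → ∃ (CommonOut π u v)
weight1⇒commonOut π u v w≡1 =
  Counting.count-positive⇒witness (commonOut? π u v) (subst (0 ℕ.<_) (sym w≡1) (ℕ.n<1+n 0))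

weight0⇒noCommonOut : ∀ {n} (π : Permutation′ n) u v → weight π u v ≡ 0 → ∀ k → ¬ CommonOut π u v k
weight0⇒noCommonOut π u v = Counting.count-zero⇒none (commonOut? π u v)

⟨$⟩ʳ-injective : ∀ {n} (π : Permutation′ n) {i j} → π ⟨$⟩ʳ i ≡ π ⟨$⟩ʳ j → i ≡ j
⟨$⟩ʳ-injective π {i} {j} e = trans (sym (inverseˡ π)) (trans (cong (π ⟨$⟩ˡ_) e) (inverseˡ π))

≢∧≯⇒< : ∀ {n} {i j : Fin n} → i ≢ j → ¬ (j < i) → i < j
≢∧≯⇒< {i = i} {j} i≢j j≮i with <-cmp i j
... | tri< i<j _ _ = i<j
... | tri≈ _ i≡j _ = ⊥-elim (i≢j i≡j)
... | tri> _ _ j<i = ⊥-elim (j≮i j<i)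

separation : ∀ {n} (π : Permutation′ n) {u v k} →
  (∀ c → ¬ CommonOut π u v c) → Arc π u k → k < v → (π ⟨$⟩ʳ v) < (π ⟨$⟩ʳ k)
separation π {v = v} {k} none arc-uk k<v =
  ≢∧≯⇒< (λ e → <⇒≢ k<v (sym (⟨$⟩ʳ-injective π e)))
         (λ πk<πv → none k (arc-uk , (k<v , πk<πv)))

penultimate<last : ∀ k → inject₁ (fromℕ k) < fromℕ (suc k)
penultimate<last k
  rewrite toℕ-inject₁ (fromℕ k) | toℕ-fromℕ k = ℕ.n<1+n k

leftOfCentre-belowCentre : ∀ {n} (π : Permutation′ n) {a x y d c : Fin n} →
  (∀ e → ¬ CommonOut π x y e) → x < y → x ≢ a →
  CommonOut π a x d → CommonOut π a y c →
  (x < a) × ((π ⟨$⟩ʳ y) < (π ⟨$⟩ʳ a))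
leftOfCentre-belowCentre π {a} {x} {y} {d} {c} none x<y x≢a (arc-ad , arc-xd) (arc-ac , arc-yc) =
  ≢∧≯⇒< x≢a a≮x , <-trans πy<πd (proj₂ arc-ad)
  where
  πy<πd : (π ⟨$⟩ʳ y) < (π ⟨$⟩ʳ d)
  πy<πd = separation π none arc-xd (<-trans (proj₁ arc-xd) x<y)

  none-swapped : ∀ e → ¬ CommonOut π y x e
  none-swapped e (arc-y , arc-x) = none e (arc-x , arc-y)

  -- If a < x, the values close up into the cycle π y < π d < π x < π c < π y.
  a≮x : ¬ (a < x)
  a≮x a<x = <-irrefl refl
    (<-trans πy<πd (<-trans (proj₂ arc-xd) (<-trans πx<πc (proj₂ arc-yc))))
    where
    πx<πc : (π ⟨$⟩ʳ x) < (π ⟨$⟩ʳ c)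
    πx<πc = separation π none-swapped arc-yc (<-trans (proj₁ arc-ac) a<x)

mainTheorem9 : (k n : ℕ) (π : Permutation′ n) →
    InWInvStar (suc (suc k)) π →
    (a : Fin n) (b : Fin (suc (suc k)) → Fin n) →
    IsStarCopy (suc (suc k)) π a b →
    (∀ i j → i < j → b i < b j) →
    (b (inject₁ (fromℕ k)) < a) × ((π ⟨$⟩ʳ b (fromℕ (suc k))) < (π ⟨$⟩ʳ a))
mainTheorem9 k n π _ a b (_ , leaf≢centre , edge , nonEdge) increasing =
  leftOfCentre-belowCentre π none x<y (leaf≢centre _)
    (proj₂ (weight1⇒commonOut π a x (edge _)))
    (proj₂ (weight1⇒commonOut π a y (edge _)))
  where
  x = b (inject₁ (fromℕ k))
  y = b (fromℕ (suc k))
  x<y : x < y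
  x<y = increasing _ _ (penultimate<last k)
  none : ∀ e → ¬ CommonOut π x y e
  none = weight0⇒noCommonOut π x y
    (nonEdge x y (<⇒≢ x<y) (λ (_ , x≡a , _) → leaf≢centre _ x≡a)
                           (λ (_ , _ , y≡a) → leaf≢centre _ y≡a))
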